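{- Let $d\geqslant 2$ and $m\geqslant 1$ be integers and let $f_1,\dots,f_d\in\mathbb{Z}[X_1,\dots,X_m]$. Let $\mathcal{S}=\{(f_1(n),\dots,f_d(n)) : n\in\mathbb{Z}^m\}\subseteq\mathbb{Z}^d$. Let $1\leqslant i\leqslant d$ be such that the map $f_i:\mathbb{Z}^m\to\mathbb{Z}$ is surjective, and let $\mathcal{H}_i=\{(x_1,\dots,x_d)\in\mathbb{Z}^d : x_i=0\}$. Then $\mathcal{H}_i$ is a complement of $\mathcal{S}$ in $\mathbb{Z}^d$. Moreover, if $\mathcal{S}\cap\mathcal{H}_i$ contains exactly one element, then $\mathcal{H}_i$ is a minimal complement of $\mathcal{S}$.
   Context: A complement of $\mathcal{S}$ in $\mathbb{Z}^d$ is a nonempty $M\subseteq\mathbb{Z}^d$ with $M+\mathcal{S}=\mathbb{Z}^d$; it is minimal if no proper subset of $M$ is a complement of $\mathcal{S}$. -}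

module Defs where

open import Data.Nat using (ℕ)
open import Data.Integer using (ℤ; +_) renaming (_+_ to _+ℤ_; _*_ to _*ℤ_)
open import Data.Fin using (Fin)
open import Data.Vec using (Vec; lookup; map; zipWith)
open import Data.Product using (Σ; ∃; _×_; _,_)
open import Relation.Binary.PropositionalEquality using (_≡_)
open import Relation.Nullary using (¬_)
open import Level using (0ℓ)
open import Relation.Unary using (Pred; _⊆_)

-- Polynomials in ℤ[X_1,…,X_m], represented syntactically (every polynomial
-- is built from integer constants and variables by + and *).
data Poly (m : ℕ) : Set where
  const : ℤ → Poly m
  var   : Fin m → Poly m
  _⊕_   : Poly m → Poly m → Poly m
  _⊗_   : Poly m → Poly m → Poly m

eval : ∀ {m} → Poly m → Vec ℤ m → ℤ
eval (const c) n = c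
eval (var j)   n = lookup n j
eval (p ⊕ q)   n = eval p n +ℤ eval q n
eval (p ⊗ q)   n = eval p n *ℤ eval q n

Subset : ℕ → Set₁
Subset d = Pred (Vec ℤ d) 0ℓ

_+ᵥ_ : ∀ {d} → Vec ℤ d → Vec ℤ d → Vec ℤ d
_+ᵥ_ = zipWith _+ℤ_

imageSet : ∀ {d m} → Vec (Poly m) d → Subset d
imageSet fs x = ∃ λ n → x ≡ map (λ f → eval f n) fs

hyperplane : ∀ {d} → Fin d → Subset d
hyperplane i x = lookup x i ≡ + 0

IsComplement : ∀ {d} → Subset d → Subset d → Set
IsComplement {d} S M =
  (∃ λ x → M x) ×
  ((z : Vec ℤ d) → ∃ λ x → ∃ λ s → M x × S s × z ≡ x +ᵥ s)

IsMinimalComplement : ∀ {d} → Subset d → Subset d → Set₁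
IsMinimalComplement {d} S M =
  IsComplement S M ×
  ((M' : Subset d) → M' ⊆ M → ¬ (M ⊆ M') → ¬ IsComplement S M')

ExactlyOne : ∀ {d} → Subset d → Set
ExactlyOne {d} A = ∃ λ s → A s × ((t : Vec ℤ d) → A t → t ≡ s)

SurjectivePoly : ∀ {m} → Poly m → Set
SurjectivePoly {m} f = (z : ℤ) → ∃ λ (n : Vec ℤ m) → eval f n ≡ z

-- Given z ∈ ℤ^d, surjectivity of f_i yields s ∈ S with s_i = z_i, and z = (z − s) + s with
-- z − s ∈ H_i. For minimality, let s₀ be the unique point of S ∩ H_i and M ⊆ H_i a complement.
-- For h ∈ H_i write h + s₀ = x + s with x ∈ M and s ∈ S; comparing i-th coordinates gives
-- s ∈ H_i, so s = s₀ and hence h = x ∈ M. Thus M = H_i.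
module Submission where

open import Defs
open import Data.Nat using (ℕ; _≥_)
open import Data.Fin using (Fin)
open import Data.Vec using (Vec; []; _∷_; head; tail; lookup; map; replicate; zipWith)
open import Data.Vec.Properties using (lookup-map; lookup-replicate; lookup-zipWith)
open import Data.Product using (_×_; _,_; ∃)
open import Relation.Unary using (_∩_; _⊆_)
open import Relation.Binary.PropositionalEquality
  using (_≡_; refl; sym; trans; cong; cong₂; subst; module ≡-Reasoning)
open import Data.Integer using (ℤ; +_; _+_; _-_)
open import Data.Integer.Properties using (+-0-abelianGroup; +-identityˡ; +-inverseʳ)
open import Algebra.Properties.AbelianGroup +-0-abelianGroup
  using () renaming (//-rightDividesˡ to i-j+j≡i; ∙-cancelʳ to +-cancelʳ)

private
  variable
    d : ℕ

_-ᵥ_ : Vec ℤ d → Vec ℤ d → Vec ℤ d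
_-ᵥ_ = zipWith _-_

-ᵥ-+ᵥ-cancel : (z s : Vec ℤ d) → (z -ᵥ s) +ᵥ s ≡ z
-ᵥ-+ᵥ-cancel []       []       = refl
-ᵥ-+ᵥ-cancel (z ∷ zs) (s ∷ ss) = cong₂ _∷_ (i-j+j≡i s z) (-ᵥ-+ᵥ-cancel zs ss)

+ᵥ-cancelʳ : (x y s : Vec ℤ d) → x +ᵥ s ≡ y +ᵥ s → x ≡ y
+ᵥ-cancelʳ []       []       []       _  = refl
+ᵥ-cancelʳ (x ∷ xs) (y ∷ ys) (s ∷ ss) eq =
  cong₂ _∷_ (+-cancelʳ s x y (cong head eq)) (+ᵥ-cancelʳ xs ys ss (cong tail eq))

lookup-+ᵥ : (x y : Vec ℤ d) (i : Fin d) → lookup (x +ᵥ y) i ≡ lookup x i + lookup y i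
lookup-+ᵥ x y i = lookup-zipWith _+_ i x y

hyperplane-+ᵥ-closed : (i : Fin d) (x y : Vec ℤ d) →
  hyperplane i x → hyperplane i y → hyperplane i (x +ᵥ y)
hyperplane-+ᵥ-closed i x y x∈H y∈H = trans (lookup-+ᵥ x y i) (cong₂ _+_ x∈H y∈H)

hyperplane-+ᵥ-cancelˡ : (i : Fin d) (x y : Vec ℤ d) →
  hyperplane i x → hyperplane i (x +ᵥ y) → hyperplane i y
hyperplane-+ᵥ-cancelˡ i x y x∈H x+y∈H = begin
  lookup y i              ≡⟨ +-identityˡ (lookup y i) ⟨
  + 0 + lookup y i        ≡⟨ cong (_+ lookup y i) x∈H ⟨
  lookup x i + lookup y i ≡⟨ lookup-+ᵥ x y i ⟨
  lookup (x +ᵥ y) i       ≡⟨ x+y∈H ⟩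
  + 0                     ∎
  where open ≡-Reasoning

CoordinateSurjective : Subset d → Fin d → Set
CoordinateSurjective S i = (c : ℤ) → ∃ λ s → S s × lookup s i ≡ c

hyperplane-isComplement : (S : Subset d) (i : Fin d) →
  CoordinateSurjective S i → IsComplement S (hyperplane i)
hyperplane-isComplement {d} S i surj = (replicate d (+ 0) , lookup-replicate i (+ 0)) , cover
  where
  cover : (z : Vec ℤ d) → ∃ λ x → ∃ λ s → hyperplane i x × S s × z ≡ x +ᵥ s
  cover z with surj (lookup z i)
  ... | s , s∈S , sᵢ≡zᵢ = z -ᵥ s , s , z-s∈H , s∈S , sym (-ᵥ-+ᵥ-cancel z s)
    where
    z-s∈H : hyperplane i (z -ᵥ s)
    z-s∈H = begin
      lookup (z -ᵥ s) i          ≡⟨ lookup-zipWith _-_ i z s ⟩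
      lookup z i - lookup s i    ≡⟨ cong (lookup z i -_) sᵢ≡zᵢ ⟩
      lookup z i - lookup z i    ≡⟨ +-inverseʳ (lookup z i) ⟩
      + 0                        ∎
      where open ≡-Reasoning

hyperplane⊆complement : (S : Subset d) (i : Fin d) → ExactlyOne (S ∩ hyperplane i) →
  (M : Subset d) → M ⊆ hyperplane i → IsComplement S M → hyperplane i ⊆ M
hyperplane⊆complement S i (s₀ , (_ , s₀∈H) , unique) M M⊆H (_ , cover) {h} h∈H
  with cover (h +ᵥ s₀)
... | x , s , x∈M , s∈S , h+s₀≡x+s = subst M x≡h x∈M
  where
  s∈H : hyperplane i s
  s∈H = hyperplane-+ᵥ-cancelˡ i x s (M⊆H x∈M)
          (subst (hyperplane i) h+s₀≡x+s (hyperplane-+ᵥ-closed i h s₀ h∈H s₀∈H))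

  x≡h : x ≡ h
  x≡h = +ᵥ-cancelʳ x h s₀ (trans (cong (x +ᵥ_) (sym (unique s (s∈S , s∈H)))) (sym h+s₀≡x+s))

hyperplane-isMinimalComplement : (S : Subset d) (i : Fin d) → IsComplement S (hyperplane i) →
  ExactlyOne (S ∩ hyperplane i) → IsMinimalComplement S (hyperplane i)
hyperplane-isMinimalComplement S i complement unique =
  complement , λ M M⊆H H⊈M M-complement → H⊈M (hyperplane⊆complement S i unique M M⊆H M-complement)

imageSet-coordinateSurjective : ∀ {m} (fs : Vec (Poly m) d) (i : Fin d) →
  SurjectivePoly (lookup fs i) → CoordinateSurjective (imageSet fs) i
imageSet-coordinateSurjective fs i surj c with surj c
... | n , fᵢ[n]≡c = map (λ f → eval f n) fs , (n , refl) , trans (lookup-map i (λ f → eval f n) fs) fᵢ[n]≡c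

proposition6p2 : (d m : ℕ) → d ≥ 2 → m ≥ 1 → (fs : Vec (Poly m) d) → (i : Fin d) →
    SurjectivePoly (lookup fs i) →
    IsComplement (imageSet fs) (hyperplane i) ×
    (ExactlyOne (imageSet fs ∩ hyperplane i) → IsMinimalComplement (imageSet fs) (hyperplane i))
proposition6p2 d m _ _ fs i surj =
  complement , hyperplane-isMinimalComplement (imageSet fs) i complement
  where
  complement : IsComplement (imageSet fs) (hyperplane i)
  complement = hyperplane-isComplement (imageSet fs) i (imageSet-coordinateSurjective fs i surj)
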